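{- Let $G=(V,E)$ be a finite graph (loops and multiple edges allowed) and let $A,B\subseteq V^2$. For $S\subseteq E$, let $\mathrm{Four}_{G,S}(A,B)$ denote the set of $(A,B)$-valid fourientations of $G$ whose set of solid edges is exactly $S$. Then the cardinality $|\mathrm{Four}_{G,S}(A,B)|$ does not depend on $S\subseteq E$.
   Context: A fourientation $\phi$ of $G$ assigns to each edge one of four configurations: 0-way (the edge cannot be traversed), 2-way (it can be traversed in both directions), or one of two 1-way configurations (it can be traversed in exactly one specified direction); loops also have these four configurations. The associated digraph $\vec\phi$ on vertex set $V$ has, for each 2-way edge, two arcs in opposite directions between its endpoints, for each 1-way edge the single arc in its allowed direction, and no arc for 0-way edges. An edge is solid if it is 0-way or 2-way. Given $A,B\subseteq V^2$, $\vec G(A,B;\phi)$ denotes the digraph obtained from $\vec\phi$ by adding an arc from $u$ to $v$ for every pair $(u,v)\in A$ and for every pair $(u,v)\in B$. The fourientation $\phi$ is $(A,B)$-valid if in $\vec G(A,B;\phi)$: (a) for every $(u,v)\in A$, there is no directed path from $v$ to $u$; and (b) for every $(u,v)\in B$, there is a directed path from $v$ to $u$. -}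

module Defs where

open import Data.Nat using (ℕ)
open import Data.Fin using (Fin)
open import Data.Bool using (Bool; true; false)
open import Data.Product using (_×_; _,_; proj₁; proj₂; Σ; ∃)
open import Data.Vec using (Vec; lookup; map)
open import Data.List using (List)
open import Data.List.Membership.Propositional using (_∈_)
open import Relation.Binary.PropositionalEquality using (_≡_)
open import Relation.Binary.Construct.Closure.ReflexiveTransitive using (Star)
open import Relation.Nullary using (¬_)

-- Each edge e has an ordered pair of endpoints
-- (tail, head); the order only serves as a reference to name the two
-- 1-way configurations.
record Graph (n m : ℕ) : Set where
  field
    ends : Fin m → Fin n × Fin n
open Graph public

data Config : Set where
  zeroWay  : Config
  twoWay   : Config
  forward  : Config   -- 1-way: from first endpoint to second
  backward : Config   -- 1-way: from second endpoint to first

Fourientation : ℕ → Set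
Fourientation m = Vec Config m

isSolid : Config → Bool
isSolid zeroWay  = true
isSolid twoWay   = true
isSolid forward  = false
isSolid backward = false

solidSet : ∀ {m} → Fourientation m → Vec Bool m
solidSet φ = map isSolid φ

-- Subsets of V² are given as finite lists of ordered pairs.
PairSet : ℕ → Set
PairSet n = List (Fin n × Fin n)

data Arc {n m : ℕ} (G : Graph n m) (A B : PairSet n) (φ : Fourientation m)
         : Fin n → Fin n → Set where
  two-f : ∀ e → lookup φ e ≡ twoWay →
          Arc G A B φ (proj₁ (ends G e)) (proj₂ (ends G e))
  two-b : ∀ e → lookup φ e ≡ twoWay →
          Arc G A B φ (proj₂ (ends G e)) (proj₁ (ends G e))
  one-f : ∀ e → lookup φ e ≡ forward →
          Arc G A B φ (proj₁ (ends G e)) (proj₂ (ends G e))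
  one-b : ∀ e → lookup φ e ≡ backward →
          Arc G A B φ (proj₂ (ends G e)) (proj₁ (ends G e))
  arcA  : ∀ {u v} → (u , v) ∈ A → Arc G A B φ u v
  arcB  : ∀ {u v} → (u , v) ∈ B → Arc G A B φ u v

Path : ∀ {n m} (G : Graph n m) (A B : PairSet n) (φ : Fourientation m)
       → Fin n → Fin n → Set
Path G A B φ = Star (Arc G A B φ)

Valid : ∀ {n m} (G : Graph n m) (A B : PairSet n) → Fourientation m → Set
Valid G A B φ =
  (∀ {u v} → (u , v) ∈ A → ¬ Path G A B φ v u) ×
  (∀ {u v} → (u , v) ∈ B → Path G A B φ v u)

InFour : ∀ {n m} (G : Graph n m) (S : Vec Bool m) (A B : PairSet n)
         → Fourientation m → Set
InFour G S A B φ = Valid G A B φ × solidSet φ ≡ S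

SameCard : {X : Set} → (X → Set) → (X → Set) → Set
SameCard {X} P Q =
  Σ (X → X) λ f → Σ (X → X) λ g →
    (∀ x → P x → Q (f x)) × (∀ y → Q y → P (g y)) ×
    (∀ x → P x → g (f x) ≡ x) × (∀ y → Q y → f (g y) ≡ y)

module Submission where

-- Fix every edge but one, k = uv, and compare the four digraphs obtained by
-- giving k each configuration. Relative to the 0-way digraph, a 1-way k adds
-- the arc u → v or v → u and a 2-way k adds both, so every path is a path of
-- the 0-way digraph or a detour through the new arc(s). More arcs make (a)
-- harder and (b) easier; beyond this monotonicity, splicing two detours
-- through opposite arcs with an arc coming from A or B yields a path that
-- validity forbids or a missing path it requires. The validity patterns that
-- survive are the six in which as many solid as 1-way configurations of k are
-- valid, and on each of them one of two fixed pairings solid ↔ 1-way preserves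
-- validity. The choice of pairing does not depend on the configuration of k,
-- so re-configuring k along it is an involution matching Four_{G,S} with
-- Four_{G,S′} whenever S and S′ differ only at k; changing S one edge at a
-- time gives the theorem. Reachability, hence validity, is decidable
-- (Floyd–Warshall), which makes the pairing computable.

open import Defs
open import Data.Nat using (ℕ)
open import Data.Bool using (Bool)
open import Data.Vec using (Vec)

open import Level using (Level; 0ℓ)
open import Function using (_∘_)
open import Data.Nat as ℕ using (zero; suc; _<_; s≤s)
open import Data.Nat.Properties using (≤∧≢⇒<)
open import Data.Fin using (Fin; zero; suc; toℕ; _≟_)
open import Data.Fin.Properties using (any?; toℕ-injective; toℕ<n)
open import Data.Bool using (true; false; not; T; _xor_)
open import Data.Bool.Properties using (not-involutive)
open import Data.Unit using (tt)
open import Data.Empty using (⊥-elim)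
open import Data.Product using (_×_; _,_; proj₁; proj₂; ∃; ∃₂)
open import Data.Product.Properties using (≡-dec)
open import Data.Sum using (_⊎_; inj₁; inj₂; [_,_]′)
open import Data.Vec using ([]; _∷_; lookup; map; _[_]≔_)
open import Data.Vec.Properties
  using (lookup∘update; lookup∘update′; []≔-idempotent; []≔-lookup; map-[]≔; lookup-map)
open import Data.List using (List)
open import Data.List.Membership.Propositional using (_∈_; find)
import Data.List.Relation.Unary.All as All
open import Data.List.Relation.Unary.All.Properties using (¬All⇒Any¬)
open import Relation.Binary.Core using (Rel; _⇒_)
open import Relation.Binary.Definitions using (Decidable; Reflexive; Transitive)
open import Relation.Binary.PropositionalEquality
open import Relation.Binary.Construct.Closure.ReflexiveTransitive as Star
  using (Star; ε; _◅_; _◅◅_)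
open import Relation.Nullary using (Dec; yes; no; ¬_)
open import Relation.Nullary.Decidable
  using (map′; _×-dec_; _⊎-dec_; ¬?; T?; isYes; decidable-stable; toWitness; fromWitness)

private
  variable
    ℓ : Level
    X : Set

∀∈? : {P : X → Set} → (∀ x → Dec (P x)) → (xs : List X) → Dec (∀ {x} → x ∈ xs → P x)
∀∈? P? xs = map′ All.lookup All.tabulate (All.all? P? xs)

¬∀∈⇒∃∈¬ : {P : X → Set} {xs : List X} → (∀ x → Dec (P x)) →
          ¬ (∀ {x} → x ∈ xs → P x) → ∃ λ x → x ∈ xs × ¬ P x
¬∀∈⇒∃∈¬ P? ¬∀ = find (¬All⇒Any¬ P? _ (¬∀ ∘ All.lookup))

-- Reachability in a finite digraph is decidable (Floyd–Warshall)

module _ {n : ℕ} (R : Rel (Fin n) ℓ) where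

  -- Bounded k x y: paths whose intermediate vertices all have index < k.
  Bounded : ℕ → Rel (Fin n) ℓ
  Bounded zero    x y = x ≡ y ⊎ R x y
  Bounded (suc k) x y = Bounded k x y ⊎ ∃ λ w → toℕ w ≡ k × Bounded k x w × Bounded k w y

  Bounded⇒Star : ∀ k → Bounded k ⇒ Star R
  Bounded⇒Star zero    (inj₁ refl)              = ε
  Bounded⇒Star zero    (inj₂ r)                 = r ◅ ε
  Bounded⇒Star (suc k) (inj₁ p)                 = Bounded⇒Star k p
  Bounded⇒Star (suc k) (inj₂ (_ , _ , p , q)) = Bounded⇒Star k p ◅◅ Bounded⇒Star k q

  Bounded-weaken : ∀ k → Bounded zero ⇒ Bounded k
  Bounded-weaken zero    p = p
  Bounded-weaken (suc k) p = inj₁ (Bounded-weaken k p)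

  Bounded-into : ∀ k {x w} → toℕ w ≡ k → Bounded (suc k) x w → Bounded k x w
  Bounded-into k _   (inj₁ p) = p
  Bounded-into k w≡k (inj₂ (w′ , w′≡k , p , _)) with toℕ-injective (trans w′≡k (sym w≡k))
  ... | refl = p

  Bounded-out-of : ∀ k {w y} → toℕ w ≡ k → Bounded (suc k) w y → Bounded k w y
  Bounded-out-of k _   (inj₁ p) = p
  Bounded-out-of k w≡k (inj₂ (w′ , w′≡k , _ , q)) with toℕ-injective (trans w′≡k (sym w≡k))
  ... | refl = q

  Bounded-trans : ∀ k {x y z} → toℕ y < k → Bounded k x y → Bounded k y z → Bounded k x z
  Bounded-trans (suc k) {y = y} (s≤s y≤k) p q with toℕ y ℕ.≟ k
  ... | yes y≡k = inj₂ (y , y≡k , Bounded-into k y≡k p , Bounded-out-of k y≡k q)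
  ... | no y≢k with ≤∧≢⇒< y≤k y≢k | p | q
  ... | y<k | inj₁ p′ | inj₁ q′ = inj₁ (Bounded-trans k y<k p′ q′)
  ... | y<k | inj₁ p′ | inj₂ (w , w≡k , q₁ , q₂) = inj₂ (w , w≡k , Bounded-trans k y<k p′ q₁ , q₂)
  ... | y<k | inj₂ (w , w≡k , p₁ , p₂) | inj₁ q′ = inj₂ (w , w≡k , p₁ , Bounded-trans k y<k p₂ q′)
  ... | _ | inj₂ (w , w≡k , p₁ , _) | inj₂ (w′ , w′≡k , _ , q₂)
    with toℕ-injective (trans w≡k (sym w′≡k))
  ... | refl = inj₂ (w , w≡k , p₁ , q₂)

  Star⇒Bounded : Star R ⇒ Bounded n
  Star⇒Bounded ε                   = Bounded-weaken n (inj₁ refl)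
  Star⇒Bounded (_◅_ {j = w} r p) =
    Bounded-trans n (toℕ<n w) (Bounded-weaken n (inj₂ r)) (Star⇒Bounded p)

  module _ (R? : Decidable R) where

    Bounded? : ∀ k → Decidable (Bounded k)
    Bounded? zero    x y = (x ≟ y) ⊎-dec R? x y
    Bounded? (suc k) x y =
      Bounded? k x y ⊎-dec any? λ w → (toℕ w ℕ.≟ k) ×-dec Bounded? k x w ×-dec Bounded? k w y

    Star? : Decidable (Star R)
    Star? x y = map′ (Bounded⇒Star n) Star⇒Bounded (Bounded? n x y)

-- Paths after adding an arc s → t and/or an arc t → s

module _ {X : Set} (R : Rel X ℓ) where

  Through : X → X → Rel X ℓ
  Through s t x y = Star R x s × Star R t y

  through-cross : ∀ {s t x y x′ y′} →
                  Through s t x y → Through t s x′ y′ → Star R y x → Star R x′ y′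
  through-cross (x⇝s , t⇝y) (x′⇝t , s⇝y′) y⇝x = x′⇝t ◅◅ t⇝y ◅◅ y⇝x ◅◅ x⇝s ◅◅ s⇝y′

  data WithArcs (s t : X) (F B : Set) : Rel X ℓ where
    old     : ∀ {x y} → R x y → WithArcs s t F B x y
    along   : F → WithArcs s t F B s t
    against : B → WithArcs s t F B t s

  Detour : (s t : X) (F B : Set) → Rel X ℓ
  Detour s t F B x y = Star R x y ⊎ (F × Through s t x y) ⊎ (B × Through t s x y)

  module _ {s t : X} {F B : Set} where

    Star-WithArcs⇒Detour : Star (WithArcs s t F B) ⇒ Detour s t F B
    -- A walk using the new arcs more than once is shortcut at s or t.
    Star-WithArcs⇒Detour ε = inj₁ ε
    Star-WithArcs⇒Detour (old r ◅ p) with Star-WithArcs⇒Detour p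
    ... | inj₁ y⇝z                      = inj₁ (r ◅ y⇝z)
    ... | inj₂ (inj₁ (f , y⇝s , t⇝z)) = inj₂ (inj₁ (f , r ◅ y⇝s , t⇝z))
    ... | inj₂ (inj₂ (b , y⇝t , s⇝z)) = inj₂ (inj₂ (b , r ◅ y⇝t , s⇝z))
    Star-WithArcs⇒Detour (along f ◅ p) with Star-WithArcs⇒Detour p
    ... | inj₁ t⇝z                   = inj₂ (inj₁ (f , ε , t⇝z))
    ... | inj₂ (inj₁ (_ , _ , t⇝z)) = inj₂ (inj₁ (f , ε , t⇝z))
    ... | inj₂ (inj₂ (_ , _ , s⇝z)) = inj₁ s⇝z
    Star-WithArcs⇒Detour (against b ◅ p) with Star-WithArcs⇒Detour p
    ... | inj₁ s⇝z                   = inj₂ (inj₂ (b , ε , s⇝z))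
    ... | inj₂ (inj₁ (_ , _ , t⇝z)) = inj₁ t⇝z
    ... | inj₂ (inj₂ (_ , _ , s⇝z)) = inj₂ (inj₂ (b , ε , s⇝z))

    Detour⇒Star-WithArcs : Detour s t F B ⇒ Star (WithArcs s t F B)
    Detour⇒Star-WithArcs (inj₁ p)                      = Star.map old p
    Detour⇒Star-WithArcs (inj₂ (inj₁ (f , x⇝s , t⇝y))) =
      Star.map old x⇝s ◅◅ along f ◅ Star.map old t⇝y
    Detour⇒Star-WithArcs (inj₂ (inj₂ (b , x⇝t , s⇝y))) =
      Star.map old x⇝t ◅◅ against b ◅ Star.map old s⇝y

passesForward passesBackward : Config → Bool
passesForward twoWay  = true
passesForward forward = true
passesForward _       = false
passesBackward twoWay   = true
passesBackward backward = true
passesBackward _        = false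

passes : (P : Config → Bool) {c d : Config} → c ≡ d → T (P d) → T (P c)
passes P c≡d = subst (T ∘ P) (sym c≡d)

record _≼_ (c d : Config) : Set where
  constructor _,_
  field
    forward-≼  : T (passesForward c) → T (passesForward d)
    backward-≼ : T (passesBackward c) → T (passesBackward d)
open _≼_

≼-refl : ∀ {c} → c ≼ c
≼-refl = (λ f → f) , (λ b → b)

zeroWay-≼ : ∀ {c} → zeroWay ≼ c
zeroWay-≼ = (λ ()) , (λ ())

≼-twoWay : ∀ {c} → c ≼ twoWay
≼-twoWay = (λ _ → tt) , (λ _ → tt)

straight crossed : Config → Config
straight zeroWay  = forward
straight twoWay   = backward
straight forward  = zeroWay
straight backward = twoWay
crossed zeroWay  = backward
crossed twoWay   = forward
crossed forward  = twoWay
crossed backward = zeroWay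

partner : Bool → Config → Config
partner false = straight
partner true  = crossed

partner-involutive : ∀ b c → partner b (partner b c) ≡ c
partner-involutive false = λ { zeroWay → refl ; twoWay → refl ; forward → refl ; backward → refl }
partner-involutive true  = λ { zeroWay → refl ; twoWay → refl ; forward → refl ; backward → refl }

isSolid-partner : ∀ b c → isSolid (partner b c) ≡ not (isSolid c)
isSolid-partner false = λ { zeroWay → refl ; twoWay → refl ; forward → refl ; backward → refl }
isSolid-partner true  = λ { zeroWay → refl ; twoWay → refl ; forward → refl ; backward → refl }

pick : Bool → Bool → Bool → Bool → Config → Bool
pick z t f b zeroWay  = z
pick z t f b twoWay   = t
pick z t f b forward  = f
pick z t f b backward = b

-- Validity of (zeroWay, twoWay, forward, backward) at one edge: the six
-- patterns with as many valid solid as valid 1-way configurations.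
data Balanced : Bool → Bool → Bool → Bool → Set where
  all             : Balanced true  true  true  true
  zero-forward    : Balanced true  false true  false
  zero-backward   : Balanced true  false false true
  twoWay-forward  : Balanced false true  true  false
  twoWay-backward : Balanced false true  false true
  none            : Balanced false false false false

partner-preserves : ∀ {z t f b} → Balanced z t f b →
                    ∀ c → pick z t f b (partner (z xor f) c) ≡ pick z t f b c
partner-preserves all             = λ { zeroWay → refl ; twoWay → refl ; forward → refl ; backward → refl }
partner-preserves zero-forward    = λ { zeroWay → refl ; twoWay → refl ; forward → refl ; backward → refl }
partner-preserves zero-backward   = λ { zeroWay → refl ; twoWay → refl ; forward → refl ; backward → refl }
partner-preserves twoWay-forward  = λ { zeroWay → refl ; twoWay → refl ; forward → refl ; backward → refl }
partner-preserves twoWay-backward = λ { zeroWay → refl ; twoWay → refl ; forward → refl ; backward → refl }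
partner-preserves none            = λ { zeroWay → refl ; twoWay → refl ; forward → refl ; backward → refl }

flipAt : ∀ {m} → Fin m → Vec Bool m → Vec Bool m
flipAt k S = S [ k ]≔ not (lookup S k)

flipAt-involutive : ∀ {m} (k : Fin m) S → flipAt k (flipAt k S) ≡ S
flipAt-involutive k S = begin
  (S [ k ]≔ not s) [ k ]≔ not (lookup (S [ k ]≔ not s) k)
    ≡⟨ cong (λ b → (S [ k ]≔ not s) [ k ]≔ not b) (lookup∘update k S (not s)) ⟩
  (S [ k ]≔ not s) [ k ]≔ not (not s)  ≡⟨ []≔-idempotent S k ⟩
  S [ k ]≔ not (not s)                 ≡⟨ cong (S [ k ]≔_) (not-involutive s) ⟩
  S [ k ]≔ s                           ≡⟨ []≔-lookup S k ⟩
  S                                    ∎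
  where
  open ≡-Reasoning
  s = lookup S k

SameCard-refl : {P : X → Set} → SameCard P P
SameCard-refl = (λ x → x) , (λ x → x) , (λ _ p → p) , (λ _ p → p) , (λ _ _ → refl) , (λ _ _ → refl)

SameCard-trans : {P Q R : X → Set} → SameCard P Q → SameCard Q R → SameCard P R
SameCard-trans (f , g , P⇒Qf , Q⇒Pg , gf , fg) (f′ , g′ , Q⇒Rf′ , R⇒Qg′ , g′f′ , f′g′) =
  f′ ∘ f , g ∘ g′ ,
  (λ x p → Q⇒Rf′ (f x) (P⇒Qf x p)) , (λ z r → Q⇒Pg (g′ z) (R⇒Qg′ z r)) ,
  (λ x p → trans (cong g (g′f′ (f x) (P⇒Qf x p))) (gf x p)) ,
  (λ z r → trans (cong f′ (fg (g′ z) (R⇒Qg′ z r))) (f′g′ z r))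

involution⇒SameCard : {P Q : X → Set} (f : X → X) → (∀ x → f (f x) ≡ x) →
                      (∀ {x} → P x → Q (f x)) → (∀ {y} → Q y → P (f y)) → SameCard P Q
involution⇒SameCard f ff P⇒Qf Q⇒Pf =
  f , f , (λ _ → P⇒Qf) , (λ _ → Q⇒Pf) , (λ x _ → ff x) , (λ y _ → ff y)

flips-connect : ∀ {m} (_∼_ : Rel (Vec Bool m) ℓ) → Reflexive _∼_ → Transitive _∼_ →
                (∀ S k → S ∼ flipAt k S) → ∀ S S′ → S ∼ S′
flips-connect _ ∼-refl _ _ [] [] = ∼-refl
flips-connect _∼_ ∼-refl ∼-trans ∼-flip (x ∷ xs) (y ∷ ys) =
  ∼-trans (head-step x y)
          (flips-connect (λ as bs → (y ∷ as) ∼ (y ∷ bs)) ∼-refl ∼-trans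
                         (λ S k → ∼-flip (y ∷ S) (suc k)) xs ys)
  where
  head-step : ∀ x y → (x ∷ xs) ∼ (y ∷ xs)
  head-step true  true  = ∼-refl
  head-step false false = ∼-refl
  head-step true  false = ∼-flip _ zero
  head-step false true  = ∼-flip _ zero

module _ {n m : ℕ} (G : Graph n m) (A B : PairSet n) where

  source target : Fin m → Fin n
  source e = proj₁ (ends G e)
  target e = proj₂ (ends G e)

  forward-arc : ∀ {φ} e → T (passesForward (lookup φ e)) → Arc G A B φ (source e) (target e)
  forward-arc {φ} e _ with lookup φ e in eq
  forward-arc e _  | twoWay  = two-f e eq
  forward-arc e _  | forward = one-f e eq

  backward-arc : ∀ {φ} e → T (passesBackward (lookup φ e)) → Arc G A B φ (target e) (source e)
  backward-arc {φ} e _ with lookup φ e in eq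
  backward-arc e _  | twoWay   = two-b e eq
  backward-arc e _  | backward = one-b e eq

  Arc-mono : ∀ {φ φ′} → (∀ e → lookup φ e ≼ lookup φ′ e) → Arc G A B φ ⇒ Arc G A B φ′
  Arc-mono le (two-f e p) = forward-arc e (forward-≼ (le e) (passes passesForward p tt))
  Arc-mono le (one-f e p) = forward-arc e (forward-≼ (le e) (passes passesForward p tt))
  Arc-mono le (two-b e p) = backward-arc e (backward-≼ (le e) (passes passesBackward p tt))
  Arc-mono le (one-b e p) = backward-arc e (backward-≼ (le e) (passes passesBackward p tt))
  Arc-mono le (arcA a)    = arcA a
  Arc-mono le (arcB b)    = arcB b

  _≟ₚ_ : (p q : Fin n × Fin n) → Dec (p ≡ q)
  _≟ₚ_ = ≡-dec _≟_ _≟_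

  open import Data.List.Membership.DecPropositional _≟ₚ_ using (_∈?_)

  ArcSpec : Fourientation m → Rel (Fin n) 0ℓ
  ArcSpec φ x y = (∃ λ e → T (passesForward (lookup φ e)) × ends G e ≡ (x , y))
                ⊎ (∃ λ e → T (passesBackward (lookup φ e)) × ends G e ≡ (y , x))
                ⊎ (x , y) ∈ A ⊎ (x , y) ∈ B

  ArcSpec⇒Arc : ∀ {φ} → ArcSpec φ ⇒ Arc G A B φ
  ArcSpec⇒Arc (inj₁ (e , f , refl))        = forward-arc e f
  ArcSpec⇒Arc (inj₂ (inj₁ (e , b , refl))) = backward-arc e b
  ArcSpec⇒Arc (inj₂ (inj₂ (inj₁ xy∈A)))    = arcA xy∈A
  ArcSpec⇒Arc (inj₂ (inj₂ (inj₂ xy∈B)))    = arcB xy∈B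

  Arc⇒ArcSpec : ∀ {φ} → Arc G A B φ ⇒ ArcSpec φ
  Arc⇒ArcSpec (two-f e p)  = inj₁ (e , passes passesForward p tt , refl)
  Arc⇒ArcSpec (one-f e p)  = inj₁ (e , passes passesForward p tt , refl)
  Arc⇒ArcSpec (two-b e p)  = inj₂ (inj₁ (e , passes passesBackward p tt , refl))
  Arc⇒ArcSpec (one-b e p)  = inj₂ (inj₁ (e , passes passesBackward p tt , refl))
  Arc⇒ArcSpec (arcA xy∈A) = inj₂ (inj₂ (inj₁ xy∈A))
  Arc⇒ArcSpec (arcB xy∈B) = inj₂ (inj₂ (inj₂ xy∈B))

  arc? : ∀ φ → Decidable (Arc G A B φ)
  arc? φ x y = map′ ArcSpec⇒Arc Arc⇒ArcSpec
    (any? (λ e → T? (passesForward (lookup φ e)) ×-dec ends G e ≟ₚ (x , y))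
     ⊎-dec any? (λ e → T? (passesBackward (lookup φ e)) ×-dec ends G e ≟ₚ (y , x))
     ⊎-dec (x , y) ∈? A ⊎-dec (x , y) ∈? B)

  path? : ∀ φ → Decidable (Path G A B φ)
  path? φ = Star? (Arc G A B φ) (arc? φ)

  ValidA ValidB : Fourientation m → Set
  ValidA φ = ∀ {u v} → (u , v) ∈ A → ¬ Path G A B φ v u
  ValidB φ = ∀ {u v} → (u , v) ∈ B → Path G A B φ v u

  valid? : ∀ φ → Dec (Valid G A B φ)
  valid? φ = map′ uncurried curried (∀∈? (λ p → ¬? (path? φ (proj₂ p) (proj₁ p))) A)
       ×-dec map′ uncurried curried (∀∈? (λ p → path? φ (proj₂ p) (proj₁ p)) B)
    where
    uncurried : ∀ {P : Fin n × Fin n → Set} {xs} →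
                (∀ {p} → p ∈ xs → P p) → ∀ {u v} → (u , v) ∈ xs → P (u , v)
    uncurried h = h
    curried : ∀ {P : Fin n × Fin n → Set} {xs} →
              (∀ {u v} → (u , v) ∈ xs → P (u , v)) → ∀ {p} → p ∈ xs → P p
    curried h = h

  ¬ValidA⇒path : ∀ {φ} → ¬ ValidA φ → ∃₂ λ u v → (u , v) ∈ A × Path G A B φ v u
  ¬ValidA⇒path {φ} ¬va with ¬∀∈⇒∃∈¬ (λ p → ¬? (path? φ (proj₂ p) (proj₁ p))) (λ h → ¬va h)
  ... | (u , v) , uv∈A , ¬¬path = u , v , uv∈A , decidable-stable (path? φ v u) ¬¬path

  ¬ValidB⇒no-path : ∀ {φ} → ¬ ValidB φ → ∃₂ λ u v → (u , v) ∈ B × ¬ Path G A B φ v u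
  ¬ValidB⇒no-path {φ} ¬vb with ¬∀∈⇒∃∈¬ (λ p → path? φ (proj₂ p) (proj₁ p)) (λ h → ¬vb h)
  ... | (u , v) , uv∈B , ¬path = u , v , uv∈B , ¬path

  ValidA-antitone : ∀ {φ φ′} → Path G A B φ ⇒ Path G A B φ′ → ValidA φ′ → ValidA φ
  ValidA-antitone sub va uv∈A = va uv∈A ∘ sub

  ValidB-monotone : ∀ {φ φ′} → Path G A B φ ⇒ Path G A B φ′ → ValidB φ → ValidB φ′
  ValidB-monotone sub vb uv∈B = sub (vb uv∈B)

  Valid-between : ∀ {φ₀ φ φ₁} → Path G A B φ₀ ⇒ Path G A B φ → Path G A B φ ⇒ Path G A B φ₁ →
                  Valid G A B φ₀ → Valid G A B φ₁ → Valid G A B φ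
  Valid-between sub₀ sub₁ (_ , vb₀) (va₁ , _) =
    ValidA-antitone sub₁ va₁ , ValidB-monotone sub₀ vb₀

  -- Changing the configuration of a single edge k

  module AtEdge (ψ : Fourientation m) (k : Fin m) where

    private
      u v : Fin n
      u = source k
      v = target k

    Reach : Config → Rel (Fin n) 0ℓ
    Reach c = Path G A B (ψ [ k ]≔ c)

    V : Config → Set
    V c = Valid G A B (ψ [ k ]≔ c)

    update-mono : ∀ {c d} → c ≼ d → ∀ e → lookup (ψ [ k ]≔ c) e ≼ lookup (ψ [ k ]≔ d) e
    update-mono {c} {d} c≼d e with e ≟ k
    ... | yes refl rewrite lookup∘update k ψ c | lookup∘update k ψ d = c≼d
    ... | no e≢k   rewrite lookup∘update′ e≢k ψ c | lookup∘update′ e≢k ψ d = ≼-refl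

    Reach-mono : ∀ {c d} → c ≼ d → Reach c ⇒ Reach d
    Reach-mono c≼d = Star.map (Arc-mono (update-mono c≼d))

    ValidA-≼ : ∀ {c d} → c ≼ d → ValidA (ψ [ k ]≔ d) → ValidA (ψ [ k ]≔ c)
    ValidA-≼ c≼d = ValidA-antitone (Reach-mono c≼d)

    ValidB-≼ : ∀ {c d} → c ≼ d → ValidB (ψ [ k ]≔ c) → ValidB (ψ [ k ]≔ d)
    ValidB-≼ c≼d = ValidB-monotone (Reach-mono c≼d)

    Arc₀ : Rel (Fin n) 0ℓ
    Arc₀ = Arc G A B (ψ [ k ]≔ zeroWay)

    Arc⁺ : Config → Rel (Fin n) 0ℓ
    Arc⁺ c = WithArcs Arc₀ u v (T (passesForward c)) (T (passesBackward c))

    Arc⁺⇒Arc : ∀ {c} → Arc⁺ c ⇒ Arc G A B (ψ [ k ]≔ c)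
    Arc⁺⇒Arc (old r)         = Arc-mono (update-mono zeroWay-≼) r
    Arc⁺⇒Arc {c} (along f)   = forward-arc k (passes passesForward (lookup∘update k ψ c) f)
    Arc⁺⇒Arc {c} (against b) = backward-arc k (passes passesBackward (lookup∘update k ψ c) b)

    off-k : ∀ {c e} → e ≢ k → lookup (ψ [ k ]≔ zeroWay) e ≡ lookup (ψ [ k ]≔ c) e
    off-k {c} e≢k = trans (lookup∘update′ e≢k ψ zeroWay) (sym (lookup∘update′ e≢k ψ c))

    forward⁺ : ∀ {c} e → T (passesForward (lookup (ψ [ k ]≔ c) e)) → Arc⁺ c (source e) (target e)
    forward⁺ {c} e f with e ≟ k
    ... | yes refl = along (passes passesForward (sym (lookup∘update k ψ c)) f)
    ... | no e≢k   = old (forward-arc e (passes passesForward (off-k e≢k) f))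

    backward⁺ : ∀ {c} e → T (passesBackward (lookup (ψ [ k ]≔ c) e)) → Arc⁺ c (target e) (source e)
    backward⁺ {c} e b with e ≟ k
    ... | yes refl = against (passes passesBackward (sym (lookup∘update k ψ c)) b)
    ... | no e≢k   = old (backward-arc e (passes passesBackward (off-k e≢k) b))

    Arc⇒Arc⁺ : ∀ {c} → Arc G A B (ψ [ k ]≔ c) ⇒ Arc⁺ c
    Arc⇒Arc⁺ (two-f e p)  = forward⁺ e (passes passesForward p tt)
    Arc⇒Arc⁺ (one-f e p)  = forward⁺ e (passes passesForward p tt)
    Arc⇒Arc⁺ (two-b e p)  = backward⁺ e (passes passesBackward p tt)
    Arc⇒Arc⁺ (one-b e p)  = backward⁺ e (passes passesBackward p tt)
    Arc⇒Arc⁺ (arcA xy∈A) = old (arcA xy∈A)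
    Arc⇒Arc⁺ (arcB xy∈B) = old (arcB xy∈B)

    reach-view : ∀ {c} → Reach c ⇒ Detour Arc₀ u v (T (passesForward c)) (T (passesBackward c))
    reach-view = Star-WithArcs⇒Detour Arc₀ ∘ Star.map Arc⇒Arc⁺

    reach-unview : ∀ {c} → Detour Arc₀ u v (T (passesForward c)) (T (passesBackward c)) ⇒ Reach c
    reach-unview = Star.map Arc⁺⇒Arc ∘ Detour⇒Star-WithArcs Arc₀

    forward-detour : ∀ {x y} → Reach forward x y → ¬ Reach zeroWay x y → Through Arc₀ u v x y
    forward-detour p ¬p₀ with reach-view p
    ... | inj₁ p₀               = ⊥-elim (¬p₀ p₀)
    ... | inj₂ (inj₁ (_ , uv)) = uv
    ... | inj₂ (inj₂ (() , _))

    backward-detour : ∀ {x y} → Reach backward x y → ¬ Reach zeroWay x y → Through Arc₀ v u x y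
    backward-detour p ¬p₀ with reach-view p
    ... | inj₁ p₀               = ⊥-elim (¬p₀ p₀)
    ... | inj₂ (inj₁ (() , _))
    ... | inj₂ (inj₂ (_ , vu)) = vu

    twoWay-backward-detour : ∀ {x y} → Reach twoWay x y → ¬ Reach forward x y → Through Arc₀ v u x y
    twoWay-backward-detour p ¬pf with reach-view p
    ... | inj₁ p₀               = ⊥-elim (¬pf (Reach-mono zeroWay-≼ p₀))
    ... | inj₂ (inj₁ (_ , uv)) = ⊥-elim (¬pf (reach-unview (inj₂ (inj₁ (tt , uv)))))
    ... | inj₂ (inj₂ (_ , vu)) = vu

    twoWay-forward-detour : ∀ {x y} → Reach twoWay x y → ¬ Reach backward x y → Through Arc₀ u v x y
    twoWay-forward-detour p ¬pb with reach-view p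
    ... | inj₁ p₀               = ⊥-elim (¬pb (Reach-mono zeroWay-≼ p₀))
    ... | inj₂ (inj₁ (_ , uv)) = uv
    ... | inj₂ (inj₂ (_ , vu)) = ⊥-elim (¬pb (reach-unview (inj₂ (inj₂ (tt , vu)))))

    twoWay-split : ∀ {x y} → Reach twoWay x y → Reach forward x y ⊎ Reach backward x y
    twoWay-split p with reach-view p
    ... | inj₁ p₀               = inj₁ (Reach-mono zeroWay-≼ p₀)
    ... | inj₂ (inj₁ (_ , uv)) = inj₁ (reach-unview (inj₂ (inj₁ (tt , uv))))
    ... | inj₂ (inj₂ (_ , vu)) = inj₂ (reach-unview (inj₂ (inj₂ (tt , vu))))

    forward-backward-meet : ∀ {x y} → Reach forward x y → Reach backward x y → Reach zeroWay x y
    forward-backward-meet pf pb with reach-view pf | reach-view pb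
    ... | inj₁ p₀ | _ = p₀
    ... | _ | inj₁ p₀ = p₀
    ... | inj₂ (inj₁ (_ , x⇝u , _)) | inj₂ (inj₂ (_ , _ , u⇝y)) = x⇝u ◅◅ u⇝y
    ... | inj₂ (inj₂ (() , _)) | _
    ... | _ | inj₂ (inj₁ (() , _))

    arcA₀ : ∀ {x y} → (x , y) ∈ A → Reach zeroWay x y
    arcA₀ xy∈A = arcA xy∈A ◅ ε

    arcB₀ : ∀ {x y} → (x , y) ∈ B → Reach zeroWay x y
    arcB₀ xy∈B = arcB xy∈B ◅ ε

    zero-twoWay⇒valid : V zeroWay → V twoWay → ∀ c → V c
    zero-twoWay⇒valid v₀ v₂ _ = Valid-between (Reach-mono zeroWay-≼) (Reach-mono ≼-twoWay) v₀ v₂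

    forward-backward⇒zero : V forward → V backward → V zeroWay
    forward-backward⇒zero (af , bf) (_ , bb) =
      ValidA-≼ zeroWay-≼ af , λ uv∈B → forward-backward-meet (bf uv∈B) (bb uv∈B)

    forward-backward⇒twoWay : V forward → V backward → V twoWay
    forward-backward⇒twoWay (af , bf) (ab , _) =
      (λ uv∈A → [ af uv∈A , ab uv∈A ]′ ∘ twoWay-split) , ValidB-≼ ≼-twoWay bf

    zero⇒forward⊎backward : V zeroWay → V forward ⊎ V backward
    zero⇒forward⊎backward (a₀ , b₀) with valid? (ψ [ k ]≔ forward) | valid? (ψ [ k ]≔ backward)
    ... | yes vf | _      = inj₁ vf
    ... | no _   | yes vb = inj₂ vb
    ... | no ¬vf | no ¬vb
      with ¬ValidA⇒path (λ af → ¬vf (af , ValidB-≼ zeroWay-≼ b₀))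
         | ¬ValidA⇒path (λ ab → ¬vb (ab , ValidB-≼ zeroWay-≼ b₀))
    ... | _ , _ , p∈A , pf | _ , _ , q∈A , pb =
      ⊥-elim (a₀ q∈A (through-cross Arc₀ (forward-detour pf (a₀ p∈A)) (backward-detour pb (a₀ q∈A))
                                       (arcA₀ p∈A)))

    twoWay⇒forward⊎backward : V twoWay → V forward ⊎ V backward
    twoWay⇒forward⊎backward (a₂ , b₂) with valid? (ψ [ k ]≔ forward) | valid? (ψ [ k ]≔ backward)
    ... | yes vf | _      = inj₁ vf
    ... | no _   | yes vb = inj₂ vb
    ... | no ¬vf | no ¬vb
      with ¬ValidB⇒no-path (λ bf → ¬vf (ValidA-≼ ≼-twoWay a₂ , bf))
         | ¬ValidB⇒no-path (λ bb → ¬vb (ValidA-≼ ≼-twoWay a₂ , bb))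
    ... | _ , _ , p∈B , ¬pf | _ , _ , q∈B , ¬pb =
      ⊥-elim (¬pf (Reach-mono zeroWay-≼
        (through-cross Arc₀ (twoWay-forward-detour (b₂ q∈B) ¬pb) (twoWay-backward-detour (b₂ p∈B) ¬pf)
                             (arcB₀ q∈B))))

    forward⇒zero⊎twoWay : V forward → V zeroWay ⊎ V twoWay
    forward⇒zero⊎twoWay (af , bf) with valid? (ψ [ k ]≔ zeroWay) | valid? (ψ [ k ]≔ twoWay)
    ... | yes v₀ | _      = inj₁ v₀
    ... | no _   | yes v₂ = inj₂ v₂
    ... | no ¬v₀ | no ¬v₂
      with ¬ValidB⇒no-path (λ b₀ → ¬v₀ (ValidA-≼ zeroWay-≼ af , b₀))
         | ¬ValidA⇒path (λ a₂ → ¬v₂ (a₂ , ValidB-≼ ≼-twoWay bf))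
    ... | _ , _ , p∈B , ¬p₀ | _ , _ , q∈A , p₂ =
      ⊥-elim (¬p₀ (through-cross Arc₀ (twoWay-backward-detour p₂ (af q∈A))
                                       (forward-detour (bf p∈B) ¬p₀)
                                       (arcA₀ q∈A)))

    backward⇒zero⊎twoWay : V backward → V zeroWay ⊎ V twoWay
    backward⇒zero⊎twoWay (ab , bb) with valid? (ψ [ k ]≔ zeroWay) | valid? (ψ [ k ]≔ twoWay)
    ... | yes v₀ | _      = inj₁ v₀
    ... | no _   | yes v₂ = inj₂ v₂
    ... | no ¬v₀ | no ¬v₂
      with ¬ValidB⇒no-path (λ b₀ → ¬v₀ (ValidA-≼ zeroWay-≼ ab , b₀))
         | ¬ValidA⇒path (λ a₂ → ¬v₂ (a₂ , ValidB-≼ ≼-twoWay bb))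
    ... | _ , _ , p∈B , ¬p₀ | _ , _ , q∈A , p₂ =
      ⊥-elim (¬p₀ (through-cross Arc₀ (twoWay-forward-detour p₂ (ab q∈A))
                                       (backward-detour (bb p∈B) ¬p₀)
                                       (arcA₀ q∈A)))

    validAt : Config → Bool
    validAt c = isYes (valid? (ψ [ k ]≔ c))

    balanced : Balanced (validAt zeroWay) (validAt twoWay) (validAt forward) (validAt backward)
    balanced = classify (valid? (ψ [ k ]≔ zeroWay)) (valid? (ψ [ k ]≔ twoWay))
                        (valid? (ψ [ k ]≔ forward)) (valid? (ψ [ k ]≔ backward))
      where
      classify : (d₀ : Dec (V zeroWay)) (d₂ : Dec (V twoWay))
                 (df : Dec (V forward)) (db : Dec (V backward)) →
                 Balanced (isYes d₀) (isYes d₂) (isYes df) (isYes db)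
      classify (yes _)  (yes _)  (yes _)  (yes _)  = all
      classify (yes v₀) (yes v₂) (no ¬vf) _        = ⊥-elim (¬vf (zero-twoWay⇒valid v₀ v₂ forward))
      classify (yes v₀) (yes v₂) (yes _)  (no ¬vb) = ⊥-elim (¬vb (zero-twoWay⇒valid v₀ v₂ backward))
      classify (yes _)  (no ¬v₂) (yes vf) (yes vb) = ⊥-elim (¬v₂ (forward-backward⇒twoWay vf vb))
      classify (yes _)  (no _)   (yes _)  (no _)   = zero-forward
      classify (yes _)  (no _)   (no _)   (yes _)  = zero-backward
      classify (yes v₀) (no _)   (no ¬vf) (no ¬vb) = ⊥-elim ([ ¬vf , ¬vb ]′ (zero⇒forward⊎backward v₀))
      classify (no ¬v₀) (yes _)  (yes vf) (yes vb) = ⊥-elim (¬v₀ (forward-backward⇒zero vf vb))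
      classify (no _)   (yes _)  (yes _)  (no _)   = twoWay-forward
      classify (no _)   (yes _)  (no _)   (yes _)  = twoWay-backward
      classify (no _)   (yes v₂) (no ¬vf) (no ¬vb) = ⊥-elim ([ ¬vf , ¬vb ]′ (twoWay⇒forward⊎backward v₂))
      classify (no ¬v₀) (no ¬v₂) (yes vf) _        = ⊥-elim ([ ¬v₀ , ¬v₂ ]′ (forward⇒zero⊎twoWay vf))
      classify (no ¬v₀) (no ¬v₂) (no _)   (yes vb) = ⊥-elim ([ ¬v₀ , ¬v₂ ]′ (backward⇒zero⊎twoWay vb))
      classify (no _)   (no _)   (no _)   (no _)   = none

    crossing : Bool
    crossing = validAt zeroWay xor validAt forward

    validAt-pick : ∀ c → validAt c ≡
                   pick (validAt zeroWay) (validAt twoWay) (validAt forward) (validAt backward) c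
    validAt-pick zeroWay  = refl
    validAt-pick twoWay   = refl
    validAt-pick forward  = refl
    validAt-pick backward = refl

    valid-partner : ∀ {c} → V c → V (partner crossing c)
    valid-partner {c} vc =
      toWitness (subst T (sym validAt-partner) (fromWitness {a? = valid? (ψ [ k ]≔ c)} vc))
      where
      validAt-partner : validAt (partner crossing c) ≡ validAt c
      validAt-partner =
        trans (validAt-pick _) (trans (partner-preserves balanced c) (sym (validAt-pick c)))

  open AtEdge using (validAt; crossing; valid-partner)

  swapAt : Fin m → Fourientation m → Fourientation m
  swapAt k χ = χ [ k ]≔ partner (crossing χ k) (lookup χ k)

  crossing-update : ∀ k χ c → crossing (χ [ k ]≔ c) k ≡ crossing χ k
  crossing-update k χ c = cong₂ _xor_ (validAt-update zeroWay) (validAt-update forward)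
    where
    validAt-update : ∀ d → validAt (χ [ k ]≔ c) k d ≡ validAt χ k d
    validAt-update _ = cong (isYes ∘ valid?) ([]≔-idempotent χ k)

  swapAt-involutive : ∀ k χ → swapAt k (swapAt k χ) ≡ χ
  swapAt-involutive k χ = begin
    (χ [ k ]≔ p) [ k ]≔ partner (crossing (χ [ k ]≔ p) k) (lookup (χ [ k ]≔ p) k)
      ≡⟨ cong₂ (λ b c → (χ [ k ]≔ p) [ k ]≔ partner b c) (crossing-update k χ p) (lookup∘update k χ p) ⟩
    (χ [ k ]≔ p) [ k ]≔ partner b p     ≡⟨ []≔-idempotent χ k ⟩
    χ [ k ]≔ partner b p                ≡⟨ cong (χ [ k ]≔_) (partner-involutive b (lookup χ k)) ⟩
    χ [ k ]≔ lookup χ k                 ≡⟨ []≔-lookup χ k ⟩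
    χ                                   ∎
    where
    open ≡-Reasoning
    b = crossing χ k
    p = partner b (lookup χ k)

  swapAt-valid : ∀ k χ → Valid G A B χ → Valid G A B (swapAt k χ)
  swapAt-valid k χ = valid-partner χ k ∘ subst (Valid G A B) (sym ([]≔-lookup χ k))

  solidSet-swapAt : ∀ k χ → solidSet (swapAt k χ) ≡ flipAt k (solidSet χ)
  solidSet-swapAt k χ = begin
    map isSolid (χ [ k ]≔ partner b c)           ≡⟨ map-[]≔ isSolid χ k ⟩
    map isSolid χ [ k ]≔ isSolid (partner b c)   ≡⟨ cong (map isSolid χ [ k ]≔_) (isSolid-partner b c) ⟩
    map isSolid χ [ k ]≔ not (isSolid c)
      ≡⟨ cong (λ s → map isSolid χ [ k ]≔ not s) (sym (lookup-map k isSolid χ)) ⟩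
    flipAt k (map isSolid χ)                     ∎
    where
    open ≡-Reasoning
    b = crossing χ k
    c = lookup χ k

  InFour-flipAt : ∀ S k → SameCard (InFour G S A B) (InFour G (flipAt k S) A B)
  InFour-flipAt S k = involution⇒SameCard (swapAt k) (swapAt-involutive k) to from
    where
    to : ∀ {χ} → InFour G S A B χ → InFour G (flipAt k S) A B (swapAt k χ)
    to {χ} (vχ , solid≡S) = swapAt-valid k χ vχ , trans (solidSet-swapAt k χ) (cong (flipAt k) solid≡S)
    from : ∀ {χ} → InFour G (flipAt k S) A B χ → InFour G S A B (swapAt k χ)
    from {χ} (vχ , solid≡S′) =
      swapAt-valid k χ vχ ,
      trans (solidSet-swapAt k χ) (trans (cong (flipAt k) solid≡S′) (flipAt-involutive k S))

theorem3p1 : ∀ {n m} (G : Graph n m) (A B : PairSet n) (S S′ : Vec Bool m)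
    → SameCard (InFour G S A B) (InFour G S′ A B)
theorem3p1 G A B =
  flips-connect (λ S S′ → SameCard (InFour G S A B) (InFour G S′ A B))
                SameCard-refl SameCard-trans (InFour-flipAt G A B)
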